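{- Let $N\ge 1$ and $m\ge 1$ be integers and let $\alpha\in\mathbb{S}_m$. Then $$w^{St}_{\mathfrak{so}(N)}(\alpha)=\sum_{s:\{1,2,\dots,m\}\to\{1,-1\}}\mathrm{sign}(s)\,N^{f(\alpha_s)-1},$$ where the sum is over all $2^m$ states $s$ of $\alpha$.
   Context: $\mathbb{S}_m$ is the symmetric group on $\{1,\dots,m\}$; the elements $1,\dots,m$ are called the legs of $\alpha$. $E_{ij}$ ($1\le i,j\le N$) denotes the $N\times N$ matrix unit, and $\bar i=N+1-i$. Set $X_{ij}=E_{ij}-E_{\bar j\bar i}$; these matrices span the Lie algebra $\mathfrak{so}(N)$ in its standard (defining) representation. The value of the $\mathfrak{so}(N)$ weight system in the standard representation on $\alpha$ is $$w^{St}_{\mathfrak{so}(N)}(\alpha)=\frac1N\,\mathrm{Tr}\Big(\sum_{i_1,\dots,i_m=1}^N X_{i_1i_{\alpha(1)}}X_{i_2i_{\alpha(2)}}\cdots X_{i_mi_{\alpha(m)}}\Big),$$ the product being the ordinary matrix product. A state of $\alpha$ is a map $s:\{1,\dots,m\}\to\{1,-1\}$; $\mathrm{sign}(s)=(-1)^{\#\{l:\,s(l)=-1\}}$. The number $f(\alpha_s)$ is defined as follows (it is the number of boundary components of the surface obtained by attaching to a disc, for each cycle of $\alpha$, a polygon whose every second side is glued to the disc at the legs of that cycle, untwisted at legs in state $1$ and half-twisted at legs in state $-1$). Consider $2m$ points $l^-,l^+$, $l=1,\dots,m$. For each leg $l$ put $\mathrm{start}_s(l)=l^+$, $\mathrm{end}_s(l)=l^-$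 if $s(l)=1$, and $\mathrm{start}_s(l)=l^-$, $\mathrm{end}_s(l)=l^+$ if $s(l)=-1$. Form the $2$-regular multigraph on these $2m$ points with edges $l^+ - (l+1)^-$ for $l=1,\dots,m$ (indices mod $m$, so $m^+-1^-$ is an edge) and, for each $k=1,\dots,m$, an edge $\mathrm{start}_s(k)-\mathrm{end}_s(\alpha(k))$. Then $f(\alpha_s)$ is the number of connected components of this multigraph. -}

module Defs where

open import Data.Nat as ℕ using (_<?_; ℕ; zero; suc; NonZero; _∸_; _^_)
open import Data.Nat.DivMod using (_mod_)
open import Data.Integer as ℤ using (ℤ; _◃_)
open import Data.Fin as Fin using (Fin; toℕ; opposite; _≟_)
open import Data.Fin.Permutation using (Permutation′; _⟨$⟩ʳ_)
open import Data.Sign as Sign using (Sign)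
open import Data.Bool using (Bool; true; false; if_then_else_; _∧_; _∨_; not)
open import Data.List using (allFin; List; []; _∷_; map; foldr; concatMap; length; filter)
open import Data.Product using (_×_; _,_; proj₁; proj₂)
open import Relation.Nullary.Decidable using (⌊_⌋)
open import Data.Rational as ℚ using (ℚ)

sumℤ : List ℤ → ℤ
sumℤ = foldr ℤ._+_ (ℤ.+ 0)

ΣFin : (n : ℕ) → (Fin n → ℤ) → ℤ
ΣFin n f = sumℤ (map f (allFin n))

consF : {A : Set} {m : ℕ} → A → (Fin m → A) → Fin (suc m) → A
consF x g Fin.zero = x
consF x g (Fin.suc i) = g i

ΣFun : {A : Set} → (m : ℕ) → List A → ((Fin m → A) → ℤ) → ℤ
ΣFun zero    xs F = F (λ ())
ΣFun (suc m) xs F = sumℤ (map (λ x → ΣFun m xs (λ g → F (consF x g))) xs)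

Mat : ℕ → Set
Mat N = Fin N → Fin N → ℤ

eqᵇ : {n : ℕ} → Fin n → Fin n → Bool
eqᵇ i j = ⌊ i ≟ j ⌋

E : {N : ℕ} → Fin N → Fin N → Mat N
E i j a b = if eqᵇ a i ∧ eqᵇ b j then ℤ.+ 1 else ℤ.+ 0

_-ᴹ_ : {N : ℕ} → Mat N → Mat N → Mat N
(A -ᴹ B) a b = A a b ℤ.- B a b

_·ᴹ_ : {N : ℕ} → Mat N → Mat N → Mat N
_·ᴹ_ {N} A B a b = ΣFin N (λ c → A a c ℤ.* B c b)

Iᴹ : {N : ℕ} → Mat N
Iᴹ a b = if eqᵇ a b then ℤ.+ 1 else ℤ.+ 0

Tr : {N : ℕ} → Mat N → ℤ
Tr {N} A = ΣFin N (λ a → A a a)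

-- X_{ij} = E_{ij} - E_{ī j̄ } with ī = N + 1 - i (0-indexed: opposite)
X : {N : ℕ} → Fin N → Fin N → Mat N
X i j = E i j -ᴹ E (opposite j) (opposite i)

prodᴹ : {N : ℕ} (m : ℕ) → (Fin m → Mat N) → Mat N
prodᴹ m M = foldr _·ᴹ_ Iᴹ (map M (allFin m))

wMatrix : (N m : ℕ) → Permutation′ m → Mat N
wMatrix N m α a b =
  ΣFun m (allFin N) (λ i → prodᴹ m (λ l → X (i l) (i (α ⟨$⟩ʳ l))) a b)

wSt-so : (N : ℕ) .{{_ : NonZero N}} (m : ℕ) → Permutation′ m → ℚ
wSt-so N m α = Tr (wMatrix N m α) ℚ./ N

-- a state assigns a sign (+ ↔ 1, - ↔ -1) to each leg
State : ℕ → Set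
State m = Fin m → Sign

signOf : {m : ℕ} → State m → Sign
signOf {m} s = foldr Sign._*_ Sign.+ (map s (allFin m))

-- vertices l⁻ (false) and l⁺ (true)
Vertex : ℕ → Set
Vertex m = Fin m × Bool

eqVᵇ : {m : ℕ} → Vertex m → Vertex m → Bool
eqVᵇ (i , b) (j , c) = eqᵇ i j ∧ (if b then c else not c)

allVertices : (m : ℕ) → List (Vertex m)
allVertices m = concatMap (λ l → (l , false) ∷ (l , true) ∷ []) (allFin m)

next : {m : ℕ} → Fin m → Fin m
next {suc k} l = suc (toℕ l) mod suc k

start : {m : ℕ} → State m → Fin m → Vertex m
start s l with s l
... | Sign.+ = l , true
... | Sign.- = l , false

end : {m : ℕ} → State m → Fin m → Vertex m
end s l with s l
... | Sign.+ = l , false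
... | Sign.- = l , true

edges : {m : ℕ} → Permutation′ m → State m → List (Vertex m × Vertex m)
edges {m} α s =
  map (λ l → (l , true) , (next l , false)) (allFin m)
  Data.List.++ map (λ k → start s k , end s (α ⟨$⟩ʳ k)) (allFin m)

anyᵇ : {A : Set} → (A → Bool) → List A → Bool
anyᵇ p = foldr (λ x r → p x ∨ r) false

reach : {m : ℕ} → List (Vertex m × Vertex m) → ℕ → Vertex m → Vertex m → Bool
reach es zero    u v = eqVᵇ u v
reach es (suc k) u v =
  reach es k u v ∨
  anyᵇ (λ e → (reach es k u (proj₁ e) ∧ eqVᵇ (proj₂ e) v)
            ∨ (reach es k u (proj₂ e) ∧ eqVᵇ (proj₁ e) v)) es

-- u and v lie in the same connected component (a walk of length < 2m suffices)
connected : {m : ℕ} → List (Vertex m × Vertex m) → Vertex m → Vertex m → Bool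
connected {m} es = reach es (2 ℕ.* m)

key : {m : ℕ} → Vertex m → ℕ
key (l , b) = 2 ℕ.* toℕ l ℕ.+ (if b then 1 else 0)

-- number of connected components = number of vertices that are the
-- first (smallest key) vertex of their component
components : {m : ℕ} → List (Vertex m × Vertex m) → ℕ
components {m} es =
  length (filter (λ v → not (anyᵇ (λ u → ⌊ key u <? key v ⌋ ∧ connected es u v)
                                  (allVertices m)) Data.Bool.≟ true)
                 (allVertices m))

f : {m : ℕ} → Permutation′ m → State m → ℕ
f α s = components (edges α s)

stateSum : (N m : ℕ) → Permutation′ m → ℤ
stateSum N m α =
  ΣFun m (Sign.- ∷ Sign.+ ∷ []) (λ s → signOf s ◃ (N ^ (f α s ∸ 1)))

{-# OPTIONS --safe #-}

-- Expanding every factor X_{ij} = E_{ij} - E_{j̄ī} turns the trace into a sum over states s of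
-- sign(s) times the number of index functions i for which the matrix units chosen by s chain up
-- cyclically.  For fixed s such an i is the same thing as a labelling of the 2m vertices l^± by
-- Fin N that is replaced by its opposite along every edge of the graph of α_s: the end vertex of
-- leg l carries i_l and its start vertex carries ī_{α(l)}.  Every vertex lies on exactly one edge of
-- each of the two perfect matchings l⁺ - (l+1)⁻ and start(k) - end(α(k)), so closed walks have
-- even length and such a labelling is freely determined by its values at one vertex of each
-- component: there are N^{f(α_s)} of them.  Dividing the trace by N gives the formula.

module Submission where

open import Defs
open import Data.Nat as ℕ using (ℕ; zero; suc; _≤_; _∸_; _^_; NonZero; z≤n; s≤s; _<?_)
import Data.Nat.Properties as ℕ
open import Data.Nat.DivMod using (_%_; m<n⇒m%n≡m; n%n≡0)
open import Data.Integer as ℤ using (ℤ; +_; -[1+_]; _+_; _-_; _*_; _◃_)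
import Data.Integer.Properties as ℤ
open import Data.Integer.Tactic.RingSolver using (solve-∀)
open import Data.Rational using (_/_)
open import Data.Rational.Unnormalised using (mkℚᵘ; *≡*)
import Data.Rational.Properties as ℚ
open import Data.Fin as Fin using (Fin; toℕ; fromℕ; inject₁; opposite; combine; remQuot)
import Data.Fin.Properties as Fin
open import Data.Fin.Relation.Unary.Top using (view; ‵fromℕ; ‵inj₁)
open import Data.Fin.Permutation using (Permutation′; _⟨$⟩ʳ_; _⟨$⟩ˡ_; inverseˡ; inverseʳ)
open import Data.Sign as Sign using (Sign)
open import Data.Bool as Bool using (Bool; true; false; not; T; _∧_; _∨_; if_then_else_)
import Data.Bool.Properties as Bool
open import Data.List as List using (List; []; _∷_; map; foldr; allFin; _++_; length; filter; reverse; lookup; concat; removeAt)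
import Data.List.Properties as List
open import Data.List.Membership.Propositional using (_∈_)
import Data.List.Membership.Propositional.Properties as ∈
open import Data.List.Relation.Unary.Any as Any using (here; there)
import Data.List.Relation.Unary.Any.Properties as Any
open import Data.List.Relation.Unary.All as All using (All; []; _∷_)
open import Data.List.Relation.Unary.All.Properties using (¬Any⇒All¬; all-filter)
open import Data.List.Relation.Unary.AllPairs using ([]; _∷_)
import Data.List.Relation.Unary.AllPairs as AllPairs
import Data.List.Relation.Unary.AllPairs.Properties as AllPairs
open import Data.List.Relation.Unary.Unique.Propositional using (Unique)
import Data.List.Relation.Unary.Unique.Propositional.Properties as Unique
open import Data.List.Extrema.Nat using (argmin; argmin-all; f[argmin]≤f[xs])
open import Data.Product as Product using (∃-syntax; _×_; _,_; proj₁; proj₂)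
import Data.Product.Properties as Product
open import Data.Sum using (_⊎_; inj₁; inj₂)
open import Data.Empty using (⊥; ⊥-elim)
open import Data.Unit using (⊤; tt)
open import Function using (_∘_)
open import Function.Bundles using (mk⇔)
open import Relation.Binary.Definitions using (DecidableEquality)
open import Relation.Binary.PropositionalEquality
open import Relation.Nullary using (¬_; Dec; yes; no; does; contradiction)
open import Relation.Nullary.Decidable using (⌊_⌋; ⌊⌋-map′; isYes≗does; dec-true; dec-false; toWitness)

-- Finite sums and indicators

𝟙 : Bool → ℤ
𝟙 b = if b then + 1 else + 0

𝟙-∧ : ∀ a b → 𝟙 (a ∧ b) ≡ 𝟙 a * 𝟙 b
𝟙-∧ true  b = sym (ℤ.*-identityˡ (𝟙 b))
𝟙-∧ false b = refl

module _ {A : Set} where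

  Σ-cong : (xs : List A) {f g : A → ℤ} → f ≗ g → sumℤ (map f xs) ≡ sumℤ (map g xs)
  Σ-cong []       f≗g = refl
  Σ-cong (x ∷ xs) f≗g = cong₂ _+_ (f≗g x) (Σ-cong xs f≗g)

  Σ-zero : (xs : List A) → sumℤ (map (λ _ → + 0) xs) ≡ + 0
  Σ-zero []       = refl
  Σ-zero (x ∷ xs) = trans (ℤ.+-identityˡ _) (Σ-zero xs)

  Σ-+ : (xs : List A) (f g : A → ℤ) →
        sumℤ (map (λ x → f x + g x) xs) ≡ sumℤ (map f xs) + sumℤ (map g xs)
  Σ-+ []       f g = refl
  Σ-+ (x ∷ xs) f g = trans (cong (_+_ (f x + g x)) (Σ-+ xs f g)) (interchange (f x) (g x) _ _)
    where
    interchange : ∀ a b c d → (a + b) + (c + d) ≡ (a + c) + (b + d)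
    interchange = solve-∀

  Σ-*ˡ : (xs : List A) (c : ℤ) (f : A → ℤ) →
         c * sumℤ (map f xs) ≡ sumℤ (map (λ x → c * f x) xs)
  Σ-*ˡ []       c f = ℤ.*-zeroʳ c
  Σ-*ˡ (x ∷ xs) c f = trans (ℤ.*-distribˡ-+ c (f x) _) (cong (_+_ (c * f x)) (Σ-*ˡ xs c f))

  Σ-*ʳ : (xs : List A) (c : ℤ) (f : A → ℤ) →
         sumℤ (map f xs) * c ≡ sumℤ (map (λ x → f x * c) xs)
  Σ-*ʳ xs c f = trans (ℤ.*-comm _ c) (trans (Σ-*ˡ xs c f) (Σ-cong xs (λ x → ℤ.*-comm c (f x))))

  Σ-const : (xs : List A) (c : ℤ) → sumℤ (map (λ _ → c) xs) ≡ + length xs * c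
  Σ-const []       c = sym (ℤ.*-zeroˡ c)
  Σ-const (x ∷ xs) c = trans (cong (_+_ c) (Σ-const xs c)) (sym (ℤ.suc-* (+ length xs) c))

Σ-swap : ∀ {A B : Set} (xs : List A) (ys : List B) (f : A → B → ℤ) →
         sumℤ (map (λ x → sumℤ (map (f x) ys)) xs) ≡ sumℤ (map (λ y → sumℤ (map (λ x → f x y) xs)) ys)
Σ-swap []       ys f = sym (Σ-zero ys)
Σ-swap (x ∷ xs) ys f =
  trans (cong (_+_ (sumℤ (map (f x) ys))) (Σ-swap xs ys f))
        (sym (Σ-+ ys (f x) (λ y → sumℤ (map (λ x → f x y) xs))))

∧-true : ∀ {a b} → a ∧ b ≡ true → a ≡ true × b ≡ true
∧-true {true} {true} refl = refl , refl

∨-true : ∀ {a b} → a ∨ b ≡ true → a ≡ true ⊎ b ≡ true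
∨-true {true}  _  = inj₁ refl
∨-true {false} eq = inj₂ eq

⌊⌋-true : ∀ {P : Set} (P? : Dec P) → P → ⌊ P? ⌋ ≡ true
⌊⌋-true P? p = trans (isYes≗does P?) (dec-true P? p)

eqᵇ-refl : ∀ {n} (i : Fin n) → eqᵇ i i ≡ true
eqᵇ-refl i = ⌊⌋-true (i Fin.≟ i) refl

eqᵇ-sound : ∀ {n} {i j : Fin n} → eqᵇ i j ≡ true → i ≡ j
eqᵇ-sound eq = toWitness (subst T (sym eq) _)

eqᵇ-suc : ∀ {n} (i j : Fin n) → eqᵇ (Fin.suc i) (Fin.suc j) ≡ eqᵇ i j
eqᵇ-suc i j = ⌊⌋-map′ (cong Fin.suc) Fin.suc-injective (i Fin.≟ j)

map-allFin-suc : ∀ {A : Set} m (f : Fin (suc m) → A) →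
                 map f (allFin (suc m)) ≡ f Fin.zero ∷ map (f ∘ Fin.suc) (allFin m)
map-allFin-suc m f =
  cong (f Fin.zero ∷_) (trans (List.map-tabulate Fin.suc f) (sym (List.map-tabulate (λ i → i) (f ∘ Fin.suc))))

Σ-δ : ∀ N (j : Fin N) (g : Fin N → ℤ) → sumℤ (map (λ i → 𝟙 (eqᵇ i j) * g i) (allFin N)) ≡ g j
Σ-δ (suc N) j g = trans (cong sumℤ (map-allFin-suc N (λ i → 𝟙 (eqᵇ i j) * g i))) (split j)
  where
  split : ∀ j → 𝟙 (eqᵇ Fin.zero j) * g Fin.zero
                + sumℤ (map (λ i → 𝟙 (eqᵇ (Fin.suc i) j) * g (Fin.suc i)) (allFin N)) ≡ g j
  split Fin.zero = trans (cong₂ _+_ (ℤ.*-identityˡ (g Fin.zero))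
                                    (trans (Σ-cong (allFin N) (λ i → ℤ.*-zeroˡ (g (Fin.suc i)))) (Σ-zero (allFin N))))
                         (ℤ.+-identityʳ _)
  split (Fin.suc j) = trans (ℤ.+-identityˡ _)
                            (trans (Σ-cong (allFin N) (λ i → cong (λ b → 𝟙 b * g (Fin.suc i)) (eqᵇ-suc i j)))
                                   (Σ-δ N j (g ∘ Fin.suc)))

module _ {A : Set} (xs : List A) where

  ΣFun-cong : ∀ m {F G : (Fin m → A) → ℤ} → F ≗ G → ΣFun m xs F ≡ ΣFun m xs G
  ΣFun-cong zero    F≗G = F≗G _
  ΣFun-cong (suc m) F≗G = Σ-cong xs (λ x → ΣFun-cong m (λ g → F≗G (consF x g)))

  ΣFun-zero : ∀ m (F : (Fin m → A) → ℤ) → (∀ g → F g ≡ + 0) → ΣFun m xs F ≡ + 0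
  ΣFun-zero m F F≗0 = trans (ΣFun-cong m F≗0) (vanish m)
    where
    vanish : ∀ m → ΣFun m xs (λ _ → + 0) ≡ + 0
    vanish zero    = refl
    vanish (suc m) = trans (Σ-cong xs (λ _ → vanish m)) (Σ-zero xs)

  ΣFun-*ˡ : ∀ m c (F : (Fin m → A) → ℤ) → c * ΣFun m xs F ≡ ΣFun m xs (λ g → c * F g)
  ΣFun-*ˡ zero    c F = refl
  ΣFun-*ˡ (suc m) c F = trans (Σ-*ˡ xs c _) (Σ-cong xs (λ x → ΣFun-*ˡ m c _))

  ΣFun-*ʳ : ∀ m c (F : (Fin m → A) → ℤ) → ΣFun m xs F * c ≡ ΣFun m xs (λ g → F g * c)
  ΣFun-*ʳ m c F = trans (ℤ.*-comm _ c) (trans (ΣFun-*ˡ m c F) (ΣFun-cong m (λ g → ℤ.*-comm c (F g))))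

  ΣFun-Σ-swap : ∀ {B : Set} m (ys : List B) (F : (Fin m → A) → B → ℤ) →
                ΣFun m xs (λ g → sumℤ (map (F g) ys)) ≡ sumℤ (map (λ y → ΣFun m xs (λ g → F g y)) ys)
  ΣFun-Σ-swap zero    ys F = refl
  ΣFun-Σ-swap (suc m) ys F =
    trans (Σ-cong xs (λ x → ΣFun-Σ-swap m ys (F ∘ consF x)))
          (Σ-swap xs ys (λ x y → ΣFun m xs (λ g → F (consF x g) y)))

ΣFun-swap : ∀ {A B : Set} m k (xs : List A) (ys : List B) (F : (Fin m → A) → (Fin k → B) → ℤ) →
            ΣFun m xs (λ g → ΣFun k ys (F g)) ≡ ΣFun k ys (λ h → ΣFun m xs (λ g → F g h))
ΣFun-swap zero    k xs ys F = refl
ΣFun-swap (suc m) k xs ys F =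
  trans (Σ-cong xs (λ x → ΣFun-swap m k xs ys (F ∘ consF x)))
        (sym (ΣFun-Σ-swap ys k xs (λ h x → ΣFun m xs (λ g → F (consF x g) h))))

ΣFun-const : ∀ N k → ΣFun k (allFin N) (λ _ → + 1) ≡ + (N ^ k)
ΣFun-const N zero    = refl
ΣFun-const N (suc k) = begin
  sumℤ (map (λ _ → ΣFun k (allFin N) (λ _ → + 1)) (allFin N))  ≡⟨ Σ-cong (allFin N) (λ _ → ΣFun-const N k) ⟩
  sumℤ (map (λ _ → + (N ^ k)) (allFin N))                      ≡⟨ Σ-const (allFin N) (+ (N ^ k)) ⟩
  + length (allFin N) * + (N ^ k)                              ≡⟨ cong (λ l → + l * + (N ^ k)) (List.length-tabulate {n = N} (λ i → i)) ⟩
  + N * + (N ^ k)                                              ≡⟨ ℤ.pos-* N (N ^ k) ⟨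
  + (N ^ suc k)                                                ∎
  where open ≡-Reasoning

eqFunᵇ : ∀ {N} m → (Fin m → Fin N) → (Fin m → Fin N) → Bool
eqFunᵇ zero    g h = true
eqFunᵇ (suc m) g h = eqᵇ (g Fin.zero) (h Fin.zero) ∧ eqFunᵇ m (g ∘ Fin.suc) (h ∘ Fin.suc)

eqFunᵇ-sound : ∀ {N} m {g h : Fin m → Fin N} → eqFunᵇ m g h ≡ true → g ≗ h
eqFunᵇ-sound (suc m) eq Fin.zero    = eqᵇ-sound (proj₁ (∧-true eq))
eqFunᵇ-sound (suc m) eq (Fin.suc j) = eqFunᵇ-sound m (proj₂ (∧-true eq)) j

eqFunᵇ-complete : ∀ {N} m {g h : Fin m → Fin N} → g ≗ h → eqFunᵇ m g h ≡ true
eqFunᵇ-complete zero    g≗h = refl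
eqFunᵇ-complete (suc m) {g} {h} g≗h =
  cong₂ _∧_ (trans (cong (λ x → eqᵇ x (h Fin.zero)) (g≗h Fin.zero)) (eqᵇ-refl (h Fin.zero)))
            (eqFunᵇ-complete m (g≗h ∘ Fin.suc))

ΣFun-δ : ∀ N m (h : Fin m → Fin N) → ΣFun m (allFin N) (λ g → 𝟙 (eqFunᵇ m g h)) ≡ + 1
ΣFun-δ N zero    h = refl
ΣFun-δ N (suc m) h = begin
  sumℤ (map (λ x → ΣFun m (allFin N) (λ g → 𝟙 (eqᵇ x h₀ ∧ eqFunᵇ m g h'))) (allFin N))
    ≡⟨ Σ-cong (allFin N) (λ x → ΣFun-cong (allFin N) m (λ g → 𝟙-∧ (eqᵇ x h₀) (eqFunᵇ m g h'))) ⟩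
  sumℤ (map (λ x → ΣFun m (allFin N) (λ g → 𝟙 (eqᵇ x h₀) * 𝟙 (eqFunᵇ m g h'))) (allFin N))
    ≡⟨ Σ-cong (allFin N) (λ x → ΣFun-*ˡ (allFin N) m (𝟙 (eqᵇ x h₀)) (λ g → 𝟙 (eqFunᵇ m g h'))) ⟨
  sumℤ (map (λ x → 𝟙 (eqᵇ x h₀) * ΣFun m (allFin N) (λ g → 𝟙 (eqFunᵇ m g h'))) (allFin N))
    ≡⟨ Σ-cong (allFin N) (λ x → cong (𝟙 (eqᵇ x h₀) *_) (ΣFun-δ N m h')) ⟩
  sumℤ (map (λ x → 𝟙 (eqᵇ x h₀) * + 1) (allFin N))
    ≡⟨ Σ-δ N h₀ (λ _ → + 1) ⟩
  + 1 ∎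
  where
  open ≡-Reasoning
  h₀ = h Fin.zero
  h' = h ∘ Fin.suc

-- Products of matrix units

signs : List Sign
signs = Sign.- ∷ Sign.+ ∷ []

choose : {A : Set} → Sign → A → A → A
choose Sign.+ p q = p
choose Sign.- p q = q

_•ᴹ_ : ∀ {N} → ℤ → Mat N → Mat N
(c •ᴹ M) a b = c * M a b

ΣMat : ∀ {A : Set} {N} → List A → (A → Mat N) → Mat N
ΣMat xs C a b = sumℤ (map (λ x → C x a b) xs)

module _ {N : ℕ} where

  prodᴹ-suc : ∀ m (M : Fin (suc m) → Mat N) x y →
              prodᴹ (suc m) M x y ≡ sumℤ (map (λ c → M Fin.zero x c * prodᴹ m (M ∘ Fin.suc) c y) (allFin N))
  prodᴹ-suc m M x y = cong (λ Ms → foldr _·ᴹ_ Iᴹ Ms x y) (map-allFin-suc m M)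

  prodᴹ-cong : ∀ m {M M' : Fin m → Mat N} → (∀ l a b → M l a b ≡ M' l a b) →
               ∀ x y → prodᴹ m M x y ≡ prodᴹ m M' x y
  prodᴹ-cong zero    M≗M' x y = refl
  prodᴹ-cong (suc m) {M} {M'} M≗M' x y = begin
    prodᴹ (suc m) M x y
      ≡⟨ prodᴹ-suc m M x y ⟩
    sumℤ (map (λ c → M Fin.zero x c * prodᴹ m (M ∘ Fin.suc) c y) (allFin N))
      ≡⟨ Σ-cong (allFin N) (λ c → cong₂ _*_ (M≗M' Fin.zero x c) (prodᴹ-cong m (M≗M' ∘ Fin.suc) c y)) ⟩
    sumℤ (map (λ c → M' Fin.zero x c * prodᴹ m (M' ∘ Fin.suc) c y) (allFin N))
      ≡⟨ prodᴹ-suc m M' x y ⟨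
    prodᴹ (suc m) M' x y ∎
    where open ≡-Reasoning

  prodᴹ-ΣMat : ∀ {A : Set} m (xs : List A) (C : Fin m → A → Mat N) x y →
               prodᴹ m (λ l → ΣMat xs (C l)) x y ≡ ΣFun m xs (λ s → prodᴹ m (λ l → C l (s l)) x y)
  prodᴹ-ΣMat zero    xs C x y = refl
  prodᴹ-ΣMat (suc m) xs C x y = begin
    prodᴹ (suc m) (λ l → ΣMat xs (C l)) x y
      ≡⟨ prodᴹ-suc m (λ l → ΣMat xs (C l)) x y ⟩
    sumℤ (map (λ c → ΣMat xs (C Fin.zero) x c * prodᴹ m (λ l → ΣMat xs (C (Fin.suc l))) c y) (allFin N))
      ≡⟨ Σ-cong (allFin N) (λ c → cong (ΣMat xs (C Fin.zero) x c *_) (prodᴹ-ΣMat m xs (C ∘ Fin.suc) c y)) ⟩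
    sumℤ (map (λ c → ΣMat xs (C Fin.zero) x c * ΣFun m xs (λ g → P g c y)) (allFin N))
      ≡⟨ Σ-cong (allFin N) (λ c → trans (Σ-*ʳ xs _ (λ σ → C Fin.zero σ x c))
                                         (Σ-cong xs (λ σ → ΣFun-*ˡ xs m (C Fin.zero σ x c) (λ g → P g c y)))) ⟩
    sumℤ (map (λ c → sumℤ (map (λ σ → ΣFun m xs (λ g → term σ g c)) xs)) (allFin N))
      ≡⟨ Σ-swap (allFin N) xs (λ c σ → ΣFun m xs (λ g → term σ g c)) ⟩
    sumℤ (map (λ σ → sumℤ (map (λ c → ΣFun m xs (λ g → term σ g c)) (allFin N))) xs)
      ≡⟨ Σ-cong xs (λ σ → sym (ΣFun-Σ-swap xs m (allFin N) (λ g c → term σ g c))) ⟩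
    sumℤ (map (λ σ → ΣFun m xs (λ g → sumℤ (map (term σ g) (allFin N)))) xs)
      ≡⟨ Σ-cong xs (λ σ → ΣFun-cong xs m (λ g → sym (prodᴹ-suc m (λ l → C l (consF σ g l)) x y))) ⟩
    ΣFun (suc m) xs (λ s → prodᴹ (suc m) (λ l → C l (s l)) x y) ∎
    where
    open ≡-Reasoning
    P : (Fin m → _) → Mat N
    P g = prodᴹ m (λ l → C (Fin.suc l) (g l))
    term : _ → (Fin m → _) → Fin N → ℤ
    term σ g c = C Fin.zero σ x c * P g c y

  prodᴹ-signed : ∀ m (s : State m) (M : Fin m → Mat N) x y →
                 prodᴹ m (λ l → (s l ◃ 1) •ᴹ M l) x y ≡ (signOf s ◃ 1) * prodᴹ m M x y
  prodᴹ-signed zero    s M x y = sym (ℤ.*-identityˡ (Iᴹ x y))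
  prodᴹ-signed (suc m) s M x y = begin
    prodᴹ (suc m) (λ l → (s l ◃ 1) •ᴹ M l) x y
      ≡⟨ prodᴹ-suc m (λ l → (s l ◃ 1) •ᴹ M l) x y ⟩
    sumℤ (map (λ c → (σ ◃ 1) * M Fin.zero x c * prodᴹ m (λ l → (s (Fin.suc l) ◃ 1) •ᴹ M (Fin.suc l)) c y)
              (allFin N))
      ≡⟨ Σ-cong (allFin N) (λ c →
           trans (cong ((σ ◃ 1) * M Fin.zero x c *_) (prodᴹ-signed m (s ∘ Fin.suc) (M ∘ Fin.suc) c y))
                 (interchange (σ ◃ 1) (M Fin.zero x c) (τ ◃ 1) (prodᴹ m (M ∘ Fin.suc) c y))) ⟩
    sumℤ (map (λ c → ((σ ◃ 1) * (τ ◃ 1)) * (M Fin.zero x c * prodᴹ m (M ∘ Fin.suc) c y)) (allFin N))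
      ≡⟨ Σ-*ˡ (allFin N) ((σ ◃ 1) * (τ ◃ 1)) _ ⟨
    ((σ ◃ 1) * (τ ◃ 1)) * sumℤ (map (λ c → M Fin.zero x c * prodᴹ m (M ∘ Fin.suc) c y) (allFin N))
      ≡⟨ cong₂ _*_ (sym (ℤ.◃-distrib-* σ τ 1 1)) (sym (prodᴹ-suc m M x y)) ⟩
    ((σ Sign.* τ) ◃ 1) * prodᴹ (suc m) M x y
      ≡⟨ cong (λ t → (t ◃ 1) * prodᴹ (suc m) M x y) (cong (foldr Sign._*_ Sign.+) (map-allFin-suc m s)) ⟨
    (signOf s ◃ 1) * prodᴹ (suc m) M x y ∎
    where
    open ≡-Reasoning
    σ = s Fin.zero
    τ = signOf (s ∘ Fin.suc)
    interchange : ∀ a b c d → a * b * (c * d) ≡ (a * c) * (b * d)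
    interchange = solve-∀

X-signed : ∀ {N} (i j : Fin N) a b →
           X i j a b ≡ ΣMat signs (λ σ → (σ ◃ 1) •ᴹ E (choose σ i (opposite j)) (choose σ j (opposite i))) a b
X-signed i j a b = difference (E i j a b) (E (opposite j) (opposite i) a b)
  where
  difference : ∀ p q → p - q ≡ -[1+ 0 ] * q + (+ 1 * p + + 0)
  difference = solve-∀

chainᵇ : ∀ {N} m (a b : Fin m → Fin N) (x y : Fin N) → Bool
chainᵇ zero    a b x y = eqᵇ x y
chainᵇ (suc m) a b x y = eqᵇ x (a Fin.zero) ∧ chainᵇ m (a ∘ Fin.suc) (b ∘ Fin.suc) (b Fin.zero) y

prodᴹ-E : ∀ {N} m (a b : Fin m → Fin N) x y → prodᴹ m (λ l → E (a l) (b l)) x y ≡ 𝟙 (chainᵇ m a b x y)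
prodᴹ-E zero    a b x y = refl
prodᴹ-E {N} (suc m) a b x y = begin
  prodᴹ (suc m) (λ l → E (a l) (b l)) x y
    ≡⟨ prodᴹ-suc m (λ l → E (a l) (b l)) x y ⟩
  sumℤ (map (λ c → 𝟙 (x≡ᵇa₀ ∧ eqᵇ c (b Fin.zero)) * P c) (allFin N))
    ≡⟨ Σ-cong (allFin N) (λ c → trans (cong (_* P c) (𝟙-∧ x≡ᵇa₀ (eqᵇ c (b Fin.zero))))
                                      (ℤ.*-assoc (𝟙 x≡ᵇa₀) (𝟙 (eqᵇ c (b Fin.zero))) (P c))) ⟩
  sumℤ (map (λ c → 𝟙 x≡ᵇa₀ * (𝟙 (eqᵇ c (b Fin.zero)) * P c)) (allFin N))
    ≡⟨ Σ-*ˡ (allFin N) (𝟙 x≡ᵇa₀) (λ c → 𝟙 (eqᵇ c (b Fin.zero)) * P c) ⟨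
  𝟙 x≡ᵇa₀ * sumℤ (map (λ c → 𝟙 (eqᵇ c (b Fin.zero)) * P c) (allFin N))
    ≡⟨ cong (𝟙 x≡ᵇa₀ *_) (trans (Σ-δ N (b Fin.zero) P) (prodᴹ-E m (a ∘ Fin.suc) (b ∘ Fin.suc) (b Fin.zero) y)) ⟩
  𝟙 x≡ᵇa₀ * 𝟙 (chainᵇ m (a ∘ Fin.suc) (b ∘ Fin.suc) (b Fin.zero) y)
    ≡⟨ 𝟙-∧ x≡ᵇa₀ _ ⟨
  𝟙 (chainᵇ (suc m) a b x y) ∎
  where
  open ≡-Reasoning
  x≡ᵇa₀ = eqᵇ x (a Fin.zero)
  P : Fin N → ℤ
  P c = prodᴹ m (λ l → E (a (Fin.suc l)) (b (Fin.suc l))) c y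

cyclicᵇ : ∀ {N} m (a b : Fin (suc m) → Fin N) → Bool
cyclicᵇ m a b = chainᵇ m (a ∘ Fin.suc) (b ∘ Fin.suc) (b Fin.zero) (a Fin.zero)

Tr-prodᴹ-E : ∀ {N} m (a b : Fin (suc m) → Fin N) → Tr (prodᴹ (suc m) (λ l → E (a l) (b l))) ≡ 𝟙 (cyclicᵇ m a b)
Tr-prodᴹ-E {N} m a b =
  trans (Σ-cong (allFin N) (λ x → trans (prodᴹ-E (suc m) a b x x) (𝟙-∧ (eqᵇ x (a Fin.zero)) _)))
        (Σ-δ N (a Fin.zero) (λ x → 𝟙 (chainᵇ m (a ∘ Fin.suc) (b ∘ Fin.suc) (b Fin.zero) x)))

next-inject₁ : ∀ {k} (j : Fin k) → next {suc k} (inject₁ j) ≡ Fin.suc j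
next-inject₁ {k} j = Fin.toℕ-injective (begin
  toℕ (next (inject₁ j))           ≡⟨ Fin.toℕ-fromℕ< _ ⟩
  suc (toℕ (inject₁ j)) % suc k    ≡⟨ cong (λ t → suc t % suc k) (Fin.toℕ-inject₁ j) ⟩
  suc (toℕ j) % suc k              ≡⟨ m<n⇒m%n≡m (s≤s (Fin.toℕ<n j)) ⟩
  suc (toℕ j)                      ∎)
  where open ≡-Reasoning

next-fromℕ : ∀ k → next {suc k} (fromℕ k) ≡ Fin.zero
next-fromℕ k = Fin.toℕ-injective (begin
  toℕ (next (fromℕ k))           ≡⟨ Fin.toℕ-fromℕ< _ ⟩
  suc (toℕ (fromℕ k)) % suc k    ≡⟨ cong (λ t → suc t % suc k) (Fin.toℕ-fromℕ k) ⟩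
  suc k % suc k                  ≡⟨ n%n≡0 (suc k) ⟩
  0                              ∎)
  where open ≡-Reasoning

prev : ∀ {k} → Fin (suc k) → Fin (suc k)
prev {k}     Fin.zero    = fromℕ k
prev {suc k} (Fin.suc j) = inject₁ j

next-prev : ∀ {k} (l : Fin (suc k)) → next (prev l) ≡ l
next-prev {k}     Fin.zero    = next-fromℕ k
next-prev {suc k} (Fin.suc j) = next-inject₁ j

prev-next : ∀ {k} (l : Fin (suc k)) → prev (next l) ≡ l
prev-next {k} l with view l
... | ‵fromℕ   = cong prev (next-fromℕ k)
... | ‵inj₁ {i = j} _ = trans (cong prev (next-inject₁ j)) (prev-suc j)
  where
  prev-suc : ∀ {k} (j : Fin k) → prev (Fin.suc j) ≡ inject₁ j
  prev-suc {suc k} j = refl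

snocF : ∀ {A : Set} {k} → (Fin k → A) → A → Fin (suc k) → A
snocF {k = zero}  h y Fin.zero    = y
snocF {k = suc k} h y Fin.zero    = h Fin.zero
snocF {k = suc k} h y (Fin.suc j) = snocF (h ∘ Fin.suc) y j

snocF-inject₁ : ∀ {A : Set} {k} (h : Fin k → A) y (j : Fin k) → snocF h y (inject₁ j) ≡ h j
snocF-inject₁ {k = suc k} h y Fin.zero    = refl
snocF-inject₁ {k = suc k} h y (Fin.suc j) = snocF-inject₁ (h ∘ Fin.suc) y j

snocF-fromℕ : ∀ {A : Set} k (h : Fin k → A) y → snocF h y (fromℕ k) ≡ y
snocF-fromℕ zero    h y = refl
snocF-fromℕ (suc k) h y = snocF-fromℕ k (h ∘ Fin.suc) y

snocF-rotate : ∀ {A : Set} {k} (a : Fin (suc k) → A) → snocF (a ∘ Fin.suc) (a Fin.zero) ≗ a ∘ next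
snocF-rotate {k = k} a l with view l
... | ‵fromℕ   = trans (snocF-fromℕ k (a ∘ Fin.suc) (a Fin.zero)) (cong a (sym (next-fromℕ k)))
... | ‵inj₁ {i = j} _ = trans (snocF-inject₁ (a ∘ Fin.suc) (a Fin.zero) j) (cong a (sym (next-inject₁ j)))

consF-η : ∀ {A : Set} {k} (b : Fin (suc k) → A) → consF (b Fin.zero) (b ∘ Fin.suc) ≗ b
consF-η b Fin.zero    = refl
consF-η b (Fin.suc j) = refl

chainᵇ-sound : ∀ {N} k (a b : Fin k → Fin N) x y → chainᵇ k a b x y ≡ true → consF x b ≗ snocF a y
chainᵇ-sound zero    a b x y eq Fin.zero    = eqᵇ-sound eq
chainᵇ-sound (suc k) a b x y eq Fin.zero    = eqᵇ-sound (proj₁ (∧-true eq))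
chainᵇ-sound (suc k) a b x y eq (Fin.suc j) =
  trans (sym (consF-η b j)) (chainᵇ-sound k (a ∘ Fin.suc) (b ∘ Fin.suc) (b Fin.zero) y (proj₂ (∧-true eq)) j)

chainᵇ-complete : ∀ {N} k (a b : Fin k → Fin N) x y → consF x b ≗ snocF a y → chainᵇ k a b x y ≡ true
chainᵇ-complete zero    a b x y eq = trans (cong (λ z → eqᵇ z y) (eq Fin.zero)) (eqᵇ-refl y)
chainᵇ-complete (suc k) a b x y eq =
  cong₂ _∧_ (trans (cong (λ z → eqᵇ z (a Fin.zero)) (eq Fin.zero)) (eqᵇ-refl (a Fin.zero)))
        (chainᵇ-complete k (a ∘ Fin.suc) (b ∘ Fin.suc) (b Fin.zero) y (λ j → trans (consF-η b j) (eq (Fin.suc j))))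

cyclicᵇ-sound : ∀ {N} m (a b : Fin (suc m) → Fin N) → cyclicᵇ m a b ≡ true → b ≗ a ∘ next
cyclicᵇ-sound m a b eq l =
  trans (sym (consF-η b l))
        (trans (chainᵇ-sound m (a ∘ Fin.suc) (b ∘ Fin.suc) (b Fin.zero) (a Fin.zero) eq l) (snocF-rotate a l))

cyclicᵇ-complete : ∀ {N} m (a b : Fin (suc m) → Fin N) → b ≗ a ∘ next → cyclicᵇ m a b ≡ true
cyclicᵇ-complete m a b b≗a∘next =
  chainᵇ-complete m (a ∘ Fin.suc) (b ∘ Fin.suc) (b Fin.zero) (a Fin.zero)
    (λ l → trans (consF-η b l) (trans (b≗a∘next l) (sym (snocF-rotate a l))))

-- Graphs made of two perfect matchings

eqVᵇ-sound : ∀ {n} {u v : Vertex n} → eqVᵇ u v ≡ true → u ≡ v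
eqVᵇ-sound {u = l , b} {l' , b'} eq = cong₂ _,_ (eqᵇ-sound (proj₁ (∧-true eq))) (same-side b b' (proj₂ (∧-true eq)))
  where
  same-side : ∀ b b' → (if b then b' else not b') ≡ true → b ≡ b'
  same-side true  true  _ = refl
  same-side false false _ = refl

eqVᵇ-refl : ∀ {n} (u : Vertex n) → eqVᵇ u u ≡ true
eqVᵇ-refl (l , true)  = cong (_∧ true) (eqᵇ-refl l)
eqVᵇ-refl (l , false) = cong (_∧ true) (eqᵇ-refl l)

_≟V_ : ∀ {n} → DecidableEquality (Vertex n)
_≟V_ = Product.≡-dec Fin._≟_ Bool._≟_

legVertices : ∀ {n} → Fin n → List (Vertex n)
legVertices l = (l , false) ∷ (l , true) ∷ []

∈-allVertices : ∀ {n} (v : Vertex n) → v ∈ allVertices n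
∈-allVertices (l , b) = ∈.∈-concat⁺′ (∈-legVertices b) (∈.∈-map⁺ legVertices (∈.∈-allFin l))
  where
  ∈-legVertices : ∀ b → (l , b) ∈ legVertices l
  ∈-legVertices false = here refl
  ∈-legVertices true  = there (here refl)

length-allVertices : ∀ n → length (allVertices n) ≡ 2 ℕ.* n
length-allVertices n = trans (length-legVertices (allFin n)) (cong (2 ℕ.*_) (List.length-tabulate {n = n} (λ l → l)))
  where
  length-legVertices : (ls : List (Fin n)) → length (concat (map legVertices ls)) ≡ 2 ℕ.* length ls
  length-legVertices []       = refl
  length-legVertices (l ∷ ls) = trans (cong (suc ∘ suc) (length-legVertices ls)) (sym (ℕ.*-suc 2 (length ls)))

allVertices-unique : ∀ n → Unique (allVertices n)
allVertices-unique n =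
  Unique.concat⁺ (All.tabulate (λ {vs} vs∈ → legVertices-unique vs∈))
                 (AllPairs.map⁺ (AllPairs.map disjoint (Unique.allFin⁺ n)))
  where
  legVertices-unique : ∀ {vs} → vs ∈ map legVertices (allFin n) → Unique vs
  legVertices-unique vs∈ with ∈.∈-map⁻ legVertices vs∈
  ... | l , _ , refl = ((λ ()) ∷ []) ∷ [] ∷ []
  leg : ∀ {l : Fin n} {v} → v ∈ legVertices l → proj₁ v ≡ l
  leg (here refl)         = refl
  leg (there (here refl)) = refl
  disjoint : ∀ {l l' : Fin n} → ¬ l ≡ l' → ∀ {v} → v ∈ legVertices l × v ∈ legVertices l' → ⊥
  disjoint l≢l' (v∈l , v∈l') = l≢l' (trans (sym (leg v∈l)) (leg v∈l'))

bitFin : Bool → Fin 2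
bitFin false = Fin.zero
bitFin true  = Fin.suc Fin.zero

key-combine : ∀ {n} (v : Vertex n) → key v ≡ toℕ (combine (proj₁ v) (bitFin (proj₂ v)))
key-combine (l , false) = sym (Fin.toℕ-combine l (bitFin false))
key-combine (l , true)  = sym (Fin.toℕ-combine l (bitFin true))

key-injective : ∀ {n} {u v : Vertex n} → key u ≡ key v → u ≡ v
key-injective {u = l , b} {l' , b'} eq = cong₂ _,_ (cong proj₁ split) (bitFin-injective b b' (cong proj₂ split))
  where
  split : (l , bitFin b) ≡ (l' , bitFin b')
  split = begin
    (l , bitFin b)                      ≡⟨ Fin.remQuot-combine l (bitFin b) ⟨
    remQuot 2 (combine l (bitFin b))    ≡⟨ cong (remQuot 2) (Fin.toℕ-injective (begin
      toℕ (combine l (bitFin b))          ≡⟨ key-combine (l , b) ⟨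
      key (l , b)                         ≡⟨ eq ⟩
      key (l' , b')                       ≡⟨ key-combine (l' , b') ⟩
      toℕ (combine l' (bitFin b'))        ∎)) ⟩
    remQuot 2 (combine l' (bitFin b'))  ≡⟨ Fin.remQuot-combine l' (bitFin b') ⟩
    (l' , bitFin b')                    ∎
    where open ≡-Reasoning
  bitFin-injective : ∀ b b' → bitFin b ≡ bitFin b' → b ≡ b'
  bitFin-injective false false _ = refl
  bitFin-injective true  true  _ = refl

module _ {A : Set} (p : A → Bool) where

  anyᵇ-sound : ∀ xs → anyᵇ p xs ≡ true → ∃[ x ] x ∈ xs × p x ≡ true
  anyᵇ-sound (x ∷ xs) eq with ∨-true {p x} eq
  ... | inj₁ px   = x , here refl , px
  ... | inj₂ rest = let y , y∈ , py = anyᵇ-sound xs rest in y , there y∈ , py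

  anyᵇ-complete : ∀ {xs x} → x ∈ xs → p x ≡ true → anyᵇ p xs ≡ true
  anyᵇ-complete (here refl) px rewrite px = refl
  anyᵇ-complete {y ∷ xs} (there x∈) px rewrite anyᵇ-complete x∈ px = Bool.∨-zeroʳ (p y)

  anyᵇ-false : ∀ xs → (∀ {x} → x ∈ xs → p x ≡ false) → anyᵇ p xs ≡ false
  anyᵇ-false []       _   = refl
  anyᵇ-false (x ∷ xs) all rewrite all (here refl) = anyᵇ-false xs (all ∘ there)

module _ {A : Set} where

  ∈-removeAt : ∀ {x y : A} {xs} (x∈ : x ∈ xs) → y ∈ xs → ¬ y ≡ x → y ∈ removeAt xs (Any.index x∈)
  ∈-removeAt (here refl) (here refl) y≢x = ⊥-elim (y≢x refl)
  ∈-removeAt (here refl) (there y∈)  _   = y∈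
  ∈-removeAt (there x∈)  (here refl) _   = here refl
  ∈-removeAt (there x∈)  (there y∈)  y≢x = there (∈-removeAt x∈ y∈ y≢x)

  Unique-length-≤ : ∀ {xs ys : List A} → Unique xs → (∀ {x} → x ∈ xs → x ∈ ys) → length xs ≤ length ys
  Unique-length-≤ {[]}     _              _     = z≤n
  Unique-length-≤ {x ∷ xs} {ys} (x∉xs ∷ xs!) xs⊆ys =
    subst (suc (length xs) ≤_) (sym (List.length-removeAt′ ys (Any.index x∈ys)))
      (s≤s (Unique-length-≤ xs! (λ y∈xs →
         ∈-removeAt x∈ys (xs⊆ys (there y∈xs)) (λ y≡x → All.lookup x∉xs y∈xs (sym y≡x)))))
    where
    x∈ys = xs⊆ys (here refl)

  ∈⇒length-positive : ∀ {xs : List A} {x} → x ∈ xs → 1 ≤ length xs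
  ∈⇒length-positive (here _)  = s≤s z≤n
  ∈⇒length-positive (there _) = s≤s z≤n

  index-unique : ∀ {xs : List A} {x} → Unique xs → (x∈ : x ∈ xs) → ∀ i → lookup xs i ≡ x → Any.index x∈ ≡ i
  index-unique _            (here refl) Fin.zero    _    = refl
  index-unique (x∉ ∷ _)     (here refl) (Fin.suc i) refl = ⊥-elim (All.lookup x∉ (∈.∈-lookup i) refl)
  index-unique (x∉ ∷ _)     (there x∈)  Fin.zero    refl = ⊥-elim (All.lookup x∉ x∈ refl)
  index-unique (_ ∷ xs!)    (there x∈)  (Fin.suc i) eq   = cong Fin.suc (index-unique xs! x∈ i eq)

parity : ℕ → Bool
parity zero    = false
parity (suc n) = not (parity n)

parity-+ : ∀ a b → parity (a ℕ.+ b) ≡ parity a Bool.xor parity b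
parity-+ zero    b = refl
parity-+ (suc a) b rewrite parity-+ a b = Bool.not-distribˡ-xor (parity a) (parity b)

module TwoMatchings {n : ℕ}
  (M               : Bool → Vertex n → Vertex n)
  (M-involutive    : ∀ c v → M c (M c v) ≡ v)
  (M-fixpoint-free : ∀ c v → ¬ M c v ≡ v)
  (es              : List (Vertex n × Vertex n))
  (es-sound        : ∀ {e} → e ∈ es → ∃[ c ] proj₂ e ≡ M c (proj₁ e))
  (es-complete     : ∀ c u → (u , M c u) ∈ es ⊎ (M c u , u) ∈ es)
  where

  V : Set
  V = Vertex n

  walk : List Bool → V → V
  walk []      u = u
  walk (c ∷ r) u = M c (walk r u)

  walk-++ : ∀ r₂ r₁ u → walk (r₂ ++ r₁) u ≡ walk r₂ (walk r₁ u)
  walk-++ []       r₁ u = refl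
  walk-++ (c ∷ r₂) r₁ u = cong (M c) (walk-++ r₂ r₁ u)

  walk-reverse : ∀ r u → walk (reverse r) (walk r u) ≡ u
  walk-reverse []      u = refl
  walk-reverse (c ∷ r) u = begin
    walk (reverse (c ∷ r)) (M c (walk r u))  ≡⟨ cong (λ r' → walk r' (M c (walk r u))) (List.unfold-reverse c r) ⟩
    walk (reverse r ++ c ∷ []) (M c (walk r u))  ≡⟨ walk-++ (reverse r) (c ∷ []) _ ⟩
    walk (reverse r) (M c (M c (walk r u)))  ≡⟨ cong (walk (reverse r)) (M-involutive c (walk r u)) ⟩
    walk (reverse r) (walk r u)  ≡⟨ walk-reverse r u ⟩
    u ∎
    where open ≡-Reasoning

  Connected : V → V → Set
  Connected u v = ∃[ r ] walk r u ≡ v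

  Connected-refl : ∀ {u} → Connected u u
  Connected-refl = [] , refl

  Connected-sym : ∀ {u v} → Connected u v → Connected v u
  Connected-sym {u} (r , refl) = reverse r , walk-reverse r u

  Connected-trans : ∀ {u v w} → Connected u v → Connected v w → Connected u w
  Connected-trans {u} (r₁ , refl) (r₂ , refl) = r₂ ++ r₁ , walk-++ r₂ r₁ u

  Connected-M : ∀ c {u v} → Connected u v → Connected u (M c v)
  Connected-M c (r , refl) = c ∷ r , refl

  Connected-edge : ∀ {u w w'} → Connected u w → (w , w') ∈ es ⊎ (w' , w) ∈ es → Connected u w'
  Connected-edge (r , refl) (inj₁ e∈) with es-sound e∈
  ... | c , eq = c ∷ r , sym eq
  Connected-edge (r , refl) (inj₂ e∈) with es-sound e∈
  ... | c , eq = c ∷ r , trans (cong (M c) eq) (M-involutive c _)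

  reach-sound : ∀ k {u v} → reach es k u v ≡ true → Connected u v
  reach-sound zero    eq = [] , eqVᵇ-sound eq
  reach-sound (suc k) {u} {v} eq with ∨-true {reach es k u v} eq
  ... | inj₁ shorter = reach-sound k shorter
  ... | inj₂ extended with anyᵇ-sound _ es extended
  ... | (w₁ , w₂) , e∈ , via-e with ∨-true {reach es k u w₁ ∧ eqVᵇ w₂ v} via-e
  ... | inj₁ fwd = let u~w₁ , w₂≡v = ∧-true {reach es k u w₁} fwd in
    Connected-edge (reach-sound k u~w₁) (inj₁ (subst (λ x → (w₁ , x) ∈ es) (eqVᵇ-sound w₂≡v) e∈))
  ... | inj₂ bwd = let u~w₂ , w₁≡v = ∧-true {reach es k u w₂} bwd in
    Connected-edge (reach-sound k u~w₂) (inj₂ (subst (λ x → (x , w₂) ∈ es) (eqVᵇ-sound w₁≡v) e∈))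

  reach-refl : ∀ k u → reach es k u u ≡ true
  reach-refl zero    u = eqVᵇ-refl u
  reach-refl (suc k) u rewrite reach-refl k u = refl

  reach-extend : ∀ k {u w w'} → reach es k u w ≡ true → (w , w') ∈ es ⊎ (w' , w) ∈ es → reach es (suc k) u w' ≡ true
  reach-extend k {u} {w} {w'} u~w (inj₁ e∈) =
    trans (cong (reach es k u w' ∨_) (anyᵇ-complete _ e∈ forward)) (Bool.∨-zeroʳ _)
    where
    forward : ((reach es k u w ∧ eqVᵇ w' w') ∨ (reach es k u w' ∧ eqVᵇ w w')) ≡ true
    forward rewrite u~w | eqVᵇ-refl w' = refl
  reach-extend k {u} {w} {w'} u~w (inj₂ e∈) =
    trans (cong (reach es k u w' ∨_) (anyᵇ-complete _ e∈ backward)) (Bool.∨-zeroʳ _)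
    where
    backward : ((reach es k u w' ∧ eqVᵇ w w') ∨ (reach es k u w ∧ eqVᵇ w' w')) ≡ true
    backward rewrite u~w | eqVᵇ-refl w' = Bool.∨-zeroʳ _

  reach-complete : ∀ k r u → length r ≤ k → reach es k u (walk r u) ≡ true
  reach-complete k       []      u _         = reach-refl k u
  reach-complete (suc k) (c ∷ r) u (s≤s r≤k) = reach-extend k (reach-complete k r u r≤k) (es-complete c (walk r u))

  -- connected only inspects walks of length at most 2n, so long walks are first made simple.
  trace : List Bool → V → List V
  trace []      u = u ∷ []
  trace (c ∷ r) u = walk (c ∷ r) u ∷ trace r u

  truncate : ∀ r u {v} → Unique (trace r u) → v ∈ trace r u → ∃[ r' ] walk r' u ≡ v × Unique (trace r' u)
  truncate []      u r! (here refl)     = [] , refl , r!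
  truncate (c ∷ r) u r! (here refl)     = c ∷ r , refl , r!
  truncate (c ∷ r) u (_ ∷ r!) (there v∈) = truncate r u r! v∈

  simplify : ∀ r u → ∃[ r' ] walk r' u ≡ walk r u × Unique (trace r' u)
  simplify []      u = [] , refl , [] ∷ []
  simplify (c ∷ r) u with simplify r u
  ... | r' , r'≡r , r'! with Any.any? (M c (walk r' u) ≟V_) (trace r' u)
  ... | yes revisit = let r'' , r''≡ , r''! = truncate r' u r'! revisit in r'' , trans r''≡ (cong (M c) r'≡r) , r''!
  ... | no  fresh   = c ∷ r' , cong (M c) r'≡r , ¬Any⇒All¬ _ fresh ∷ r'!

  length-trace : ∀ r u → length (trace r u) ≡ suc (length r)
  length-trace []      u = refl
  length-trace (c ∷ r) u = cong suc (length-trace r u)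

  simple-walk-length : ∀ r u → Unique (trace r u) → length r ≤ 2 ℕ.* n
  simple-walk-length r u r! = begin
    length r                ≤⟨ ℕ.n≤1+n (length r) ⟩
    suc (length r)          ≡⟨ length-trace r u ⟨
    length (trace r u)      ≤⟨ Unique-length-≤ r! (λ {v} _ → ∈-allVertices v) ⟩
    length (allVertices n)  ≡⟨ length-allVertices n ⟩
    2 ℕ.* n                 ∎
    where open ℕ.≤-Reasoning

  connected-sound : ∀ {u v} → connected es u v ≡ true → Connected u v
  connected-sound = reach-sound (2 ℕ.* n)

  connected-complete : ∀ {u v} → Connected u v → connected es u v ≡ true
  connected-complete {u} (r , refl) with simplify r u
  ... | r' , r'≡r , r'! = subst (λ v → reach es (2 ℕ.* n) u v ≡ true) r'≡r
                                (reach-complete (2 ℕ.* n) r' u (simple-walk-length r' u r'!))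

  Alternating : List Bool → Set
  Alternating []          = ⊤
  Alternating (c ∷ [])    = ⊤
  Alternating (c ∷ d ∷ r) = d ≡ not c × Alternating (d ∷ r)

  data Reduction (r : List Bool) : Set where
    backtrack   : ∀ p c q → r ≡ p ++ c ∷ c ∷ q → Reduction r
    alternating : Alternating r → Reduction r

  reduction : ∀ r → Reduction r
  reduction []          = alternating tt
  reduction (c ∷ [])    = alternating tt
  reduction (c ∷ d ∷ r) with c Bool.≟ d | reduction (d ∷ r)
  ... | yes refl | _                  = backtrack [] c r refl
  ... | no  c≢d  | backtrack p e q eq = backtrack (c ∷ p) e q (cong (c ∷_) eq)
  ... | no  c≢d  | alternating alt    = alternating (Bool.¬-not (c≢d ∘ sym) , alt)

  odd-alternating : ∀ r → Alternating r → parity (length r) ≡ true →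
                    (∃[ c ] r ≡ c ∷ []) ⊎ (∃[ c ] ∃[ r' ] r ≡ c ∷ r' ++ c ∷ [])
  odd-alternating (c ∷ [])        _                 _   = inj₁ (c , refl)
  odd-alternating (c ∷ d ∷ e ∷ r) (refl , e≡ , alt) odd
    with odd-alternating (e ∷ r) alt (trans (sym (Bool.not-involutive _)) odd) | trans e≡ (Bool.not-involutive c)
  ... | inj₁ (_ , refl)      | refl = inj₂ (c , not c ∷ [] , refl)
  ... | inj₂ (_ , r' , refl) | refl = inj₂ (c , not c ∷ c ∷ r' , refl)

  -- Cancelling a backtrack c c, or conjugating an alternating word c ⋯ c by M c, shortens the walk
  -- by two; at length one M c would have a fixed point.
  odd-closed-walk-impossible : ∀ F r u → length r ≤ F → parity (length r) ≡ true → ¬ walk r u ≡ u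
  odd-closed-walk-impossible zero    []      u _   ()
  odd-closed-walk-impossible zero    (_ ∷ _) u ()
  odd-closed-walk-impossible (suc F) r       u r≤F odd closed with reduction r
  ... | backtrack p c q refl =
    odd-closed-walk-impossible F (p ++ q) u
      (ℕ.≤-pred (ℕ.≤-trans (ℕ.n≤1+n _) (subst (_≤ suc F) length-backtrack r≤F)))
      (trans (sym (Bool.not-involutive _)) (subst (λ l → parity l ≡ true) length-backtrack odd))
      (trans (sym walk-backtrack) closed)
    where
    length-backtrack : length (p ++ c ∷ c ∷ q) ≡ suc (suc (length (p ++ q)))
    length-backtrack = trans (List.length-++-sucʳ p c (c ∷ q)) (cong suc (List.length-++-sucʳ p c q))
    walk-backtrack : walk (p ++ c ∷ c ∷ q) u ≡ walk (p ++ q) u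
    walk-backtrack = trans (walk-++ p (c ∷ c ∷ q) u)
                           (trans (cong (walk p) (M-involutive c (walk q u))) (sym (walk-++ p q u)))
  ... | alternating alt with odd-alternating r alt odd
  ...   | inj₁ (c , refl)      = M-fixpoint-free c u closed
  ...   | inj₂ (c , r' , refl) =
    odd-closed-walk-impossible F r' (M c u)
      (ℕ.≤-pred (ℕ.≤-trans (ℕ.n≤1+n _) (subst (λ l → suc l ≤ suc F) length-snoc r≤F)))
      (trans (sym (Bool.not-involutive _)) (subst (λ l → not (parity l) ≡ true) length-snoc odd))
      (trans (sym (M-involutive c _)) (cong (M c) (trans (cong (M c) (sym (walk-++ r' (c ∷ []) u))) closed)))
    where
    length-snoc : length (r' ++ c ∷ []) ≡ suc (length r')
    length-snoc = trans (List.length-++-sucʳ r' c []) (cong (suc ∘ length) (List.++-identityʳ r'))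

  closed-walk-even : ∀ r u → walk r u ≡ u → parity (length r) ≡ false
  closed-walk-even r u closed with parity (length r) in odd
  ... | false = refl
  ... | true  = ⊥-elim (odd-closed-walk-impossible (length r) r u ℕ.≤-refl odd closed)

  isRootᵇ : V → Bool
  isRootᵇ v = not (anyᵇ (λ u → ⌊ key u <? key v ⌋ ∧ connected es u v) (allVertices n))

  -- These are exactly the vertices counted by components, so length roots is components es by definition.
  roots : List V
  roots = filter (λ v → isRootᵇ v Bool.≟ true) (allVertices n)

  -- This and the later opaque blocks stop Agda from evaluating reach when comparing terms.
  opaque
    root : V → V
    root v = argmin key v (filter (λ u → connected es u v Bool.≟ true) (allVertices n))

    root-connected : ∀ v → Connected (root v) v
    root-connected v = connected-sound
      (argmin-all key {P = λ u → connected es u v ≡ true}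
                  (connected-complete Connected-refl) (all-filter _ (allVertices n)))

    root-minimal : ∀ {u v} → Connected u v → key (root v) ≤ key u
    root-minimal {u} {v} u~v =
      All.lookup (f[argmin]≤f[xs] v _) (∈.∈-filter⁺ _ (∈-allVertices u) (connected-complete u~v))

  root-cong : ∀ {u v} → Connected u v → root u ≡ root v
  root-cong {u} {v} u~v = key-injective (ℕ.≤-antisym
    (root-minimal (Connected-trans (root-connected v) (Connected-sym u~v)))
    (root-minimal (Connected-trans (root-connected u) u~v)))

  root-isRoot : ∀ v → isRootᵇ (root v) ≡ true
  root-isRoot v = cong not (anyᵇ-false _ (allVertices n) no-smaller)
    where
    no-smaller : ∀ {u} → u ∈ allVertices n → (⌊ key u <? key (root v) ⌋ ∧ connected es u (root v)) ≡ false
    no-smaller {u} _ with key u <? key (root v)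
    ... | no  _        = refl
    ... | yes u<root with connected es u (root v) in u~root
    ...   | false = refl
    ...   | true  = ⊥-elim (ℕ.<⇒≱ u<root (root-minimal (Connected-trans (connected-sound u~root) (root-connected v))))

  isRoot⇒root≡ : ∀ {R} → isRootᵇ R ≡ true → root R ≡ R
  isRoot⇒root≡ {R} R-root with key (root R) <? key R
  ... | no  root≮R = key-injective (ℕ.≤-antisym (root-minimal Connected-refl) (ℕ.≮⇒≥ root≮R))
  ... | yes root<R = contradiction (trans (cong not (sym smaller)) R-root) λ ()
    where
    smaller : anyᵇ (λ u → ⌊ key u <? key R ⌋ ∧ connected es u R) (allVertices n) ≡ true
    smaller = anyᵇ-complete _ (∈-allVertices (root R))
                (cong₂ _∧_ (⌊⌋-true (key (root R) <? key R) root<R) (connected-complete (root-connected R)))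

  root-M : ∀ c v → root (M c v) ≡ root v
  root-M c v = sym (root-cong (Connected-M c Connected-refl))

  roots-unique : Unique roots
  roots-unique = Unique.filter⁺ _ (allVertices-unique n)

  root∈roots : ∀ v → root v ∈ roots
  root∈roots v = ∈.∈-filter⁺ _ (∈-allVertices (root v)) (root-isRoot v)

  lookup-isRoot : ∀ r → isRootᵇ (lookup roots r) ≡ true
  lookup-isRoot r = proj₂ (∈.∈-filter⁻ _ {xs = allVertices n} (∈.∈-lookup r))

  opaque
    componentOf : V → Fin (length roots)
    componentOf v = Any.index (root∈roots v)

    lookup-componentOf : ∀ v → lookup roots (componentOf v) ≡ root v
    lookup-componentOf v = sym (Any.lookup-index (root∈roots v))

    componentOf-M : ∀ c v → componentOf (M c v) ≡ componentOf v
    componentOf-M c v =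
      index-unique roots-unique (root∈roots (M c v)) (componentOf v) (trans (lookup-componentOf v) (sym (root-M c v)))

    componentOf-lookup : ∀ r → componentOf (lookup roots r) ≡ r
    componentOf-lookup r =
      index-unique roots-unique (root∈roots (lookup roots r)) r (sym (isRoot⇒root≡ (lookup-isRoot r)))

  walks-same-parity : ∀ {u v} r₁ r₂ → walk r₁ u ≡ v → walk r₂ u ≡ v → parity (length r₁) ≡ parity (length r₂)
  walks-same-parity {u} r₁ r₂ refl r₂-walk = xor≡false⇒≡ (begin
    parity (length r₁) Bool.xor parity (length r₂)  ≡⟨ parity-+ (length r₁) (length r₂) ⟨
    parity (length r₁ ℕ.+ length r₂)                 ≡⟨ cong (λ l → parity (l ℕ.+ length r₂)) (List.length-reverse r₁) ⟨
    parity (length (reverse r₁) ℕ.+ length r₂)       ≡⟨ cong parity (List.length-++ (reverse r₁)) ⟨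
    parity (length (reverse r₁ ++ r₂))               ≡⟨ closed-walk-even (reverse r₁ ++ r₂) u closed ⟩
    false                                            ∎)
    where
    open ≡-Reasoning
    closed : walk (reverse r₁ ++ r₂) u ≡ u
    closed = trans (walk-++ (reverse r₁) r₂ u) (trans (cong (walk (reverse r₁)) r₂-walk) (walk-reverse r₁ u))
    xor≡false⇒≡ : ∀ {a b} → a Bool.xor b ≡ false → a ≡ b
    xor≡false⇒≡ {false} {false} _ = refl
    xor≡false⇒≡ {true}  {true}  _ = refl

  opaque
    depthParity : V → Bool
    depthParity v = parity (length (proj₁ (root-connected v)))

    depthParity-walk : ∀ {v} r → walk r (root v) ≡ v → parity (length r) ≡ depthParity v
    depthParity-walk {v} r r-walk = walks-same-parity r (proj₁ (root-connected v)) r-walk (proj₂ (root-connected v))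

  depthParity-M : ∀ c v → depthParity (M c v) ≡ not (depthParity v)
  depthParity-M c v =
    trans (sym (depthParity-walk (c ∷ r₀) (trans (cong (walk (c ∷ r₀)) (root-M c v)) (cong (M c) r₀-walk))))
          (cong not (depthParity-walk r₀ r₀-walk))
    where
    r₀ = proj₁ (root-connected v)
    r₀-walk = proj₂ (root-connected v)

  depthParity-root : ∀ {R} → isRootᵇ R ≡ true → depthParity R ≡ false
  depthParity-root R-root = sym (depthParity-walk [] (isRoot⇒root≡ R-root))

  module Labelling {A : Set} (op : A → A) (op-involutive : ∀ x → op (op x) ≡ x) where

    flipIf : Bool → A → A
    flipIf b x = if b then op x else x

    op-flipIf : ∀ b x → op (flipIf b x) ≡ flipIf (not b) x
    op-flipIf true  x = op-involutive x
    op-flipIf false x = refl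

    AntiInvariant : (V → A) → Set
    AntiInvariant y = ∀ c v → y (M c v) ≡ op (y v)

    extend : (Fin (length roots) → A) → V → A
    extend w v = flipIf (depthParity v) (w (componentOf v))

    extend-antiInvariant : ∀ w → AntiInvariant (extend w)
    extend-antiInvariant w c v =
      trans (cong₂ flipIf (depthParity-M c v) (cong w (componentOf-M c v))) (sym (op-flipIf (depthParity v) _))

    extend-lookup : ∀ w r → extend w (lookup roots r) ≡ w r
    extend-lookup w r = cong₂ flipIf (depthParity-root (lookup-isRoot r)) (cong w (componentOf-lookup r))

    antiInvariant-walk : ∀ {y} → AntiInvariant y → ∀ r u → y (walk r u) ≡ flipIf (parity (length r)) (y u)
    antiInvariant-walk y-anti []      u = refl
    antiInvariant-walk {y} y-anti (c ∷ r) u =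
      trans (y-anti c (walk r u))
            (trans (cong op (antiInvariant-walk y-anti r u)) (op-flipIf (parity (length r)) (y u)))

    antiInvariant-extend : ∀ {y} → AntiInvariant y → extend (y ∘ lookup roots) ≗ y
    antiInvariant-extend {y} y-anti v = begin
      flipIf (depthParity v) (y (lookup roots (componentOf v)))
        ≡⟨ cong (flipIf (depthParity v) ∘ y) (lookup-componentOf v) ⟩
      flipIf (depthParity v) (y (root v))
        ≡⟨ cong (λ b → flipIf b (y (root v))) (depthParity-walk r₀ r₀-walk) ⟨
      flipIf (parity (length r₀)) (y (root v))
        ≡⟨ antiInvariant-walk y-anti r₀ (root v) ⟨
      y (walk r₀ (root v))
        ≡⟨ cong y r₀-walk ⟩
      y v ∎
      where
      open ≡-Reasoning
      r₀ = proj₁ (root-connected v)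
      r₀-walk = proj₂ (root-connected v)

-- Counting through a parametrisation

-- Without function extensionality every map has to respect pointwise equality.
record Parametrisation {N m : ℕ} (P : (Fin m → Fin N) → Bool) (k : ℕ) : Set where
  field
    encode        : (Fin m → Fin N) → Fin k → Fin N
    decode        : (Fin k → Fin N) → Fin m → Fin N
    P-resp        : ∀ {i i'} → i ≗ i' → P i ≡ true → P i' ≡ true
    encode-resp   : ∀ {i i'} → i ≗ i' → encode i ≗ encode i'
    decode-resp   : ∀ {w w'} → w ≗ w' → decode w ≗ decode w'
    decode-sound  : ∀ w → P (decode w) ≡ true
    encode-decode : ∀ w → encode (decode w) ≗ w
    decode-encode : ∀ {i} → P i ≡ true → decode (encode i) ≗ i

module _ {N m k : ℕ} {P : (Fin m → Fin N) → Bool} (π : Parametrisation P k) where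
  open Parametrisation π

  𝟙-as-Σ-fibre : ∀ i → 𝟙 (P i) ≡ ΣFun k (allFin N) (λ w → 𝟙 (eqFunᵇ m i (decode w)))
  𝟙-as-Σ-fibre i with P i in Pi
  ... | true  = sym (trans (ΣFun-cong (allFin N) k (λ w → cong 𝟙 (fibre w))) (ΣFun-δ N k (encode i)))
    where
    fibre : ∀ w → eqFunᵇ m i (decode w) ≡ eqFunᵇ k w (encode i)
    fibre w = Bool.⇔→≡ (mk⇔
      (λ i≗dw → eqFunᵇ-complete k (λ r →
         trans (sym (encode-decode w r)) (encode-resp (sym ∘ eqFunᵇ-sound m i≗dw) r)))
      (λ w≗ei → eqFunᵇ-complete m (λ j →
         trans (sym (decode-encode Pi j)) (decode-resp (sym ∘ eqFunᵇ-sound k w≗ei) j))))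
  ... | false = sym (ΣFun-zero (allFin N) k _ (λ w → cong 𝟙 (empty-fibre w)))
    where
    empty-fibre : ∀ w → eqFunᵇ m i (decode w) ≡ false
    empty-fibre w = Bool.¬-not (λ i≗dw →
      contradiction (trans (sym Pi) (P-resp (sym ∘ eqFunᵇ-sound m i≗dw) (decode-sound w))) λ ())

  count-parametrised : ΣFun m (allFin N) (λ i → 𝟙 (P i)) ≡ + (N ^ k)
  count-parametrised = begin
    ΣFun m (allFin N) (λ i → 𝟙 (P i))
      ≡⟨ ΣFun-cong (allFin N) m 𝟙-as-Σ-fibre ⟩
    ΣFun m (allFin N) (λ i → ΣFun k (allFin N) (λ w → 𝟙 (eqFunᵇ m i (decode w))))
      ≡⟨ ΣFun-swap m k (allFin N) (allFin N) (λ i w → 𝟙 (eqFunᵇ m i (decode w))) ⟩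
    ΣFun k (allFin N) (λ w → ΣFun m (allFin N) (λ i → 𝟙 (eqFunᵇ m i (decode w))))
      ≡⟨ ΣFun-cong (allFin N) k (λ w → ΣFun-δ N m (decode w)) ⟩
    ΣFun k (allFin N) (λ _ → + 1)
      ≡⟨ ΣFun-const N k ⟩
    + (N ^ k) ∎
    where open ≡-Reasoning

-- The trace as a sum over states

module _ {N m : ℕ} (α : Permutation′ m) (s : State m) (i : Fin m → Fin N) where

  row : Fin m → Fin N
  row l = choose (s l) (i l) (opposite (i (α ⟨$⟩ʳ l)))

  col : Fin m → Fin N
  col l = choose (s l) (i (α ⟨$⟩ʳ l)) (opposite (i l))

compatibleᵇ : ∀ {N m} → Permutation′ (suc m) → State (suc m) → (Fin (suc m) → Fin N) → Bool
compatibleᵇ {m = m} α s i = cyclicᵇ m (row α s i) (col α s i)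

sgn : ∀ {m} → State m → ℤ
sgn s = signOf s ◃ 1

Tr-prodᴹ-X : ∀ {N} m (α : Permutation′ (suc m)) (i : Fin (suc m) → Fin N) →
             Tr (prodᴹ (suc m) (λ l → X (i l) (i (α ⟨$⟩ʳ l)))) ≡
             ΣFun (suc m) signs (λ s → sgn s * 𝟙 (compatibleᵇ α s i))
Tr-prodᴹ-X {N} m α i = begin
  Tr (prodᴹ (suc m) (λ l → X (i l) (i (α ⟨$⟩ʳ l))))
    ≡⟨ Σ-cong (allFin N) (λ a → prodᴹ-cong (suc m) (λ l → X-signed (i l) (i (α ⟨$⟩ʳ l))) a a) ⟩
  sumℤ (map (λ a → prodᴹ (suc m) (λ l → ΣMat signs (C l)) a a) (allFin N))
    ≡⟨ Σ-cong (allFin N) (λ a → prodᴹ-ΣMat (suc m) signs C a a) ⟩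
  sumℤ (map (λ a → ΣFun (suc m) signs (λ s → prodᴹ (suc m) (λ l → C l (s l)) a a)) (allFin N))
    ≡⟨ Σ-cong (allFin N) (λ a → ΣFun-cong signs (suc m) (λ s → prodᴹ-signed (suc m) s (Eₛ s) a a)) ⟩
  sumℤ (map (λ a → ΣFun (suc m) signs (λ s → sgn s * prodᴹ (suc m) (Eₛ s) a a)) (allFin N))
    ≡⟨ ΣFun-Σ-swap signs (suc m) (allFin N) (λ s a → sgn s * prodᴹ (suc m) (Eₛ s) a a) ⟨
  ΣFun (suc m) signs (λ s → sumℤ (map (λ a → sgn s * prodᴹ (suc m) (Eₛ s) a a) (allFin N)))
    ≡⟨ ΣFun-cong signs (suc m) (λ s → trans (sym (Σ-*ˡ (allFin N) (sgn s) _))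
                                            (cong (sgn s *_) (Tr-prodᴹ-E m (row α s i) (col α s i)))) ⟩
  ΣFun (suc m) signs (λ s → sgn s * 𝟙 (compatibleᵇ α s i)) ∎
  where
  open ≡-Reasoning
  C : Fin (suc m) → Sign → Mat N
  C l σ = (σ ◃ 1) •ᴹ E (choose σ (i l) (opposite (i (α ⟨$⟩ʳ l)))) (choose σ (i (α ⟨$⟩ʳ l)) (opposite (i l)))
  Eₛ : State (suc m) → Fin (suc m) → Mat N
  Eₛ s l = E (row α s i l) (col α s i l)

Tr-wMatrix : ∀ N m (α : Permutation′ (suc m)) →
             Tr (wMatrix N (suc m) α) ≡
             ΣFun (suc m) signs (λ s → sgn s * ΣFun (suc m) (allFin N) (𝟙 ∘ compatibleᵇ α s))
Tr-wMatrix N m α = begin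
  Tr (wMatrix N (suc m) α)
    ≡⟨ ΣFun-Σ-swap (allFin N) (suc m) (allFin N) (λ i a → prodᴹ (suc m) (λ l → X (i l) (i (α ⟨$⟩ʳ l))) a a) ⟨
  ΣFun (suc m) (allFin N) (λ i → Tr (prodᴹ (suc m) (λ l → X (i l) (i (α ⟨$⟩ʳ l)))))
    ≡⟨ ΣFun-cong (allFin N) (suc m) (Tr-prodᴹ-X m α) ⟩
  ΣFun (suc m) (allFin N) (λ i → ΣFun (suc m) signs (λ s → sgn s * 𝟙 (compatibleᵇ α s i)))
    ≡⟨ ΣFun-swap (suc m) (suc m) (allFin N) signs (λ i s → sgn s * 𝟙 (compatibleᵇ α s i)) ⟩
  ΣFun (suc m) signs (λ s → ΣFun (suc m) (allFin N) (λ i → sgn s * 𝟙 (compatibleᵇ α s i)))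
    ≡⟨ ΣFun-cong signs (suc m) (λ s → sym (ΣFun-*ˡ (allFin N) (suc m) (sgn s) (𝟙 ∘ compatibleᵇ α s))) ⟩
  ΣFun (suc m) signs (λ s → sgn s * ΣFun (suc m) (allFin N) (𝟙 ∘ compatibleᵇ α s)) ∎
  where open ≡-Reasoning

-- The graph of a state

startSide : Sign → Bool
startSide Sign.+ = true
startSide Sign.- = false

module StateGraph {m : ℕ} (α : Permutation′ (suc m)) (s : State (suc m)) where

  α⟨_⟩ : Fin (suc m) → Fin (suc m)
  α⟨ l ⟩ = α ⟨$⟩ʳ l

  α⁻¹⟨_⟩ : Fin (suc m) → Fin (suc m)
  α⁻¹⟨ l ⟩ = α ⟨$⟩ˡ l

  startV : Fin (suc m) → Vertex (suc m)
  startV l = l , startSide (s l)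

  endV : Fin (suc m) → Vertex (suc m)
  endV l = l , not (startSide (s l))

  start≡startV : ∀ l → start s l ≡ startV l
  start≡startV l with s l
  ... | Sign.+ = refl
  ... | Sign.- = refl

  end≡endV : ∀ l → end s l ≡ endV l
  end≡endV l with s l
  ... | Sign.+ = refl
  ... | Sign.- = refl

  data Side : Vertex (suc m) → Set where
    at-start : ∀ l → Side (startV l)
    at-end   : ∀ l → Side (endV l)

  side : ∀ v → Side v
  side (l , b) with b Bool.≟ startSide (s l)
  ... | yes refl = at-start l
  ... | no  b≢   with refl ← Bool.¬-not b≢ = at-end l

  endV≢startV : ∀ {l l'} → ¬ endV l' ≡ startV l
  endV≢startV eq with refl ← cong proj₁ eq = Bool.not-¬ refl (sym (cong proj₂ eq))

  cyclic-edge : Vertex (suc m) → Vertex (suc m)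
  cyclic-edge (l , true)  = next l , false
  cyclic-edge (l , false) = prev l , true

  α-edge : Vertex (suc m) → Vertex (suc m)
  α-edge (l , b) = if does (b Bool.≟ startSide (s l)) then endV α⟨ l ⟩ else startV α⁻¹⟨ l ⟩

  α-edge-start : ∀ l → α-edge (startV l) ≡ endV α⟨ l ⟩
  α-edge-start l rewrite dec-true (startSide (s l) Bool.≟ startSide (s l)) refl = refl

  α-edge-end : ∀ l → α-edge (endV l) ≡ startV α⁻¹⟨ l ⟩
  α-edge-end l rewrite dec-false (not (startSide (s l)) Bool.≟ startSide (s l)) (Bool.not-¬ refl ∘ sym) = refl

  M : Bool → Vertex (suc m) → Vertex (suc m)
  M false = cyclic-edge
  M true  = α-edge

  M-involutive : ∀ c v → M c (M c v) ≡ v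
  M-involutive false (l , true)  = cong (_, true) (prev-next l)
  M-involutive false (l , false) = cong (_, false) (next-prev l)
  M-involutive true  v with side v
  ... | at-start l = trans (cong α-edge (α-edge-start l)) (trans (α-edge-end α⟨ l ⟩) (cong startV (inverseˡ α)))
  ... | at-end   l = trans (cong α-edge (α-edge-end l)) (trans (α-edge-start α⁻¹⟨ l ⟩) (cong endV (inverseʳ α)))

  M-fixpoint-free : ∀ c v → ¬ M c v ≡ v
  M-fixpoint-free false (l , true)  ()
  M-fixpoint-free false (l , false) ()
  M-fixpoint-free true  v with side v
  ... | at-start l = λ fixed → endV≢startV (trans (sym (α-edge-start l)) fixed)
  ... | at-end   l = λ fixed → endV≢startV (sym (trans (sym (α-edge-end l)) fixed))

  cyclic-edge∈ : ∀ l → ((l , true) , (next l , false)) ∈ edges α s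
  cyclic-edge∈ l = ∈.∈-++⁺ˡ (∈.∈-map⁺ (λ l → (l , true) , (next l , false)) (∈.∈-allFin l))

  α-edge∈ : ∀ l → (startV l , endV α⟨ l ⟩) ∈ edges α s
  α-edge∈ l = subst (_∈ edges α s) (cong₂ _,_ (start≡startV l) (end≡endV α⟨ l ⟩))
    (∈.∈-++⁺ʳ (map (λ l → (l , true) , (next l , false)) (allFin (suc m)))
              (∈.∈-map⁺ (λ k → start s k , end s α⟨ k ⟩) (∈.∈-allFin l)))

  edges-sound : ∀ {e} → e ∈ edges α s → ∃[ c ] proj₂ e ≡ M c (proj₁ e)
  edges-sound e∈ with ∈.∈-++⁻ (map (λ l → (l , true) , (next l , false)) (allFin (suc m))) e∈
  ... | inj₁ cyclic∈ with ∈.∈-map⁻ (λ l → (l , true) , (next l , false)) cyclic∈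
  ...   | l , _ , refl = false , refl
  edges-sound e∈ | inj₂ α∈ with ∈.∈-map⁻ (λ k → start s k , end s α⟨ k ⟩) α∈
  ...   | l , _ , refl = true , (begin
    end s α⟨ l ⟩         ≡⟨ end≡endV α⟨ l ⟩ ⟩
    endV α⟨ l ⟩          ≡⟨ α-edge-start l ⟨
    α-edge (startV l)   ≡⟨ cong α-edge (start≡startV l) ⟨
    α-edge (start s l)  ∎)
    where open ≡-Reasoning

  edges-complete : ∀ c u → (u , M c u) ∈ edges α s ⊎ (M c u , u) ∈ edges α s
  edges-complete false (l , true)  = inj₁ (cyclic-edge∈ l)
  edges-complete false (l , false) =
    inj₂ (subst (λ x → ((prev l , true) , (x , false)) ∈ edges α s) (next-prev l) (cyclic-edge∈ (prev l)))
  edges-complete true  v with side v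
  ... | at-start l = inj₁ (subst (λ x → (startV l , x) ∈ edges α s) (sym (α-edge-start l)) (α-edge∈ l))
  ... | at-end   l =
    inj₂ (subst₂ (λ x y → (x , y) ∈ edges α s) (sym (α-edge-end l)) (cong endV (inverseʳ α)) (α-edge∈ α⁻¹⟨ l ⟩))

  open TwoMatchings M M-involutive M-fixpoint-free (edges α s) edges-sound edges-complete public

  module _ {N : ℕ} where
    open Labelling {Fin N} opposite Fin.opposite-involutive

    label : (Fin (suc m) → Fin N) → Vertex (suc m) → Fin N
    label i (l , b) = if does (b Bool.≟ startSide (s l)) then opposite (i α⟨ l ⟩) else i l

    module _ (i : Fin (suc m) → Fin N) where

      label-start : ∀ l → label i (startV l) ≡ opposite (i α⟨ l ⟩)
      label-start l rewrite dec-true (startSide (s l) Bool.≟ startSide (s l)) refl = refl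

      label-end : ∀ l → label i (endV l) ≡ i l
      label-end l rewrite dec-false (not (startSide (s l)) Bool.≟ startSide (s l)) (Bool.not-¬ refl ∘ sym) = refl

      row-label : ∀ l → row α s i l ≡ label i (l , false)
      row-label l with s l
      ... | Sign.+ = refl
      ... | Sign.- = refl

      col-label : ∀ l → col α s i l ≡ opposite (label i (l , true))
      col-label l with s l
      ... | Sign.+ = sym (Fin.opposite-involutive (i α⟨ l ⟩))
      ... | Sign.- = refl

      label-α-edge : ∀ v → label i (α-edge v) ≡ opposite (label i v)
      label-α-edge v with side v
      ... | at-start l = begin
        label i (α-edge (startV l))        ≡⟨ cong (label i) (α-edge-start l) ⟩
        label i (endV α⟨ l ⟩)               ≡⟨ label-end α⟨ l ⟩ ⟩
        i α⟨ l ⟩                            ≡⟨ Fin.opposite-involutive (i α⟨ l ⟩) ⟨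
        opposite (opposite (i α⟨ l ⟩))      ≡⟨ cong opposite (label-start l) ⟨
        opposite (label i (startV l))      ∎
        where open ≡-Reasoning
      ... | at-end l = begin
        label i (α-edge (endV l))          ≡⟨ cong (label i) (α-edge-end l) ⟩
        label i (startV α⁻¹⟨ l ⟩)           ≡⟨ label-start α⁻¹⟨ l ⟩ ⟩
        opposite (i α⟨ α⁻¹⟨ l ⟩ ⟩)           ≡⟨ cong (opposite ∘ i) (inverseʳ α) ⟩
        opposite (i l)                     ≡⟨ cong opposite (label-end l) ⟨
        opposite (label i (endV l))        ∎
        where open ≡-Reasoning

      compatible⇒antiInvariant : compatibleᵇ α s i ≡ true → AntiInvariant (label i)
      compatible⇒antiInvariant compat false (l , true) = begin
        label i (next l , false)        ≡⟨ row-label (next l) ⟨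
        row α s i (next l)              ≡⟨ cyclic l ⟨
        col α s i l                     ≡⟨ col-label l ⟩
        opposite (label i (l , true))   ∎
        where
        open ≡-Reasoning
        cyclic = cyclicᵇ-sound m (row α s i) (col α s i) compat
      compatible⇒antiInvariant compat false (l , false) = begin
        label i (prev l , true)                         ≡⟨ Fin.opposite-involutive _ ⟨
        opposite (opposite (label i (prev l , true)))   ≡⟨ cong opposite (col-label (prev l)) ⟨
        opposite (col α s i (prev l))                   ≡⟨ cong opposite (cyclic (prev l)) ⟩
        opposite (row α s i (next (prev l)))            ≡⟨ cong (opposite ∘ row α s i) (next-prev l) ⟩
        opposite (row α s i l)                          ≡⟨ cong opposite (row-label l) ⟩
        opposite (label i (l , false))                  ∎
        where
        open ≡-Reasoning
        cyclic = cyclicᵇ-sound m (row α s i) (col α s i) compat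
      compatible⇒antiInvariant compat true v = label-α-edge v

      antiInvariant⇒compatible : AntiInvariant (label i) → compatibleᵇ α s i ≡ true
      antiInvariant⇒compatible anti = cyclicᵇ-complete m (row α s i) (col α s i) (λ l →
        trans (col-label l) (trans (sym (anti false (l , true))) (sym (row-label (next l)))))

      label-resp : ∀ {i'} → i ≗ i' → label i ≗ label i'
      label-resp i≗i' (l , b) =
        cong₂ (λ x y → if does (b Bool.≟ startSide (s l)) then opposite x else y) (i≗i' α⟨ l ⟩) (i≗i' l)

    compatibleᵇ-resp : ∀ {i i'} → i ≗ i' → compatibleᵇ α s i ≡ true → compatibleᵇ α s i' ≡ true
    compatibleᵇ-resp {i} {i'} i≗i' compat = antiInvariant⇒compatible i' (λ c v → begin
      label i' (M c v)             ≡⟨ label-resp i i≗i' (M c v) ⟨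
      label i (M c v)              ≡⟨ compatible⇒antiInvariant i compat c v ⟩
      opposite (label i v)         ≡⟨ cong opposite (label-resp i i≗i' v) ⟩
      opposite (label i' v)        ∎)
      where open ≡-Reasoning

    label-extend : ∀ w → label (extend w ∘ endV) ≗ extend w
    label-extend w v with side v
    ... | at-end l   = label-end (extend w ∘ endV) l
    ... | at-start l = begin
      label (extend w ∘ endV) (startV l)         ≡⟨ label-start (extend w ∘ endV) l ⟩
      opposite (extend w (endV α⟨ l ⟩))          ≡⟨ cong (opposite ∘ extend w) (α-edge-start l) ⟨
      opposite (extend w (α-edge (startV l)))    ≡⟨ cong opposite (extend-antiInvariant w true (startV l)) ⟩
      opposite (opposite (extend w (startV l)))  ≡⟨ Fin.opposite-involutive _ ⟩
      extend w (startV l)                        ∎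
      where open ≡-Reasoning

    label-extend-antiInvariant : ∀ w → AntiInvariant (label (extend w ∘ endV))
    label-extend-antiInvariant w c v =
      trans (label-extend w (M c v)) (trans (extend-antiInvariant w c v) (cong opposite (sym (label-extend w v))))

    compatible-parametrisation : Parametrisation (compatibleᵇ α s) (f α s)
    compatible-parametrisation = record
      { encode        = λ i r → label i (lookup roots r)
      ; decode        = λ w → extend w ∘ endV
      ; P-resp        = compatibleᵇ-resp
      ; encode-resp   = λ {i} i≗i' r → label-resp i i≗i' (lookup roots r)
      ; decode-resp   = λ w≗w' l → cong (flipIf (depthParity (endV l))) (w≗w' (componentOf (endV l)))
      ; decode-sound  = λ w → antiInvariant⇒compatible (extend w ∘ endV) (label-extend-antiInvariant w)
      ; encode-decode = λ w r → trans (label-extend w (lookup roots r)) (extend-lookup w r)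
      ; decode-encode = λ {i} compat l →
          trans (antiInvariant-extend (compatible⇒antiInvariant i compat) (endV l)) (label-end i l)
      }

  count-compatible : ∀ N → ΣFun (suc m) (allFin N) (𝟙 ∘ compatibleᵇ α s) ≡ + (N ^ f α s)
  count-compatible N = count-parametrised compatible-parametrisation

  f-positive : 1 ≤ f α s
  f-positive = ∈⇒length-positive (root∈roots (Fin.zero , true))

signed-power-peel : ∀ σ N f → 1 ≤ f → (σ ◃ 1) * + (N ^ f) ≡ (σ ◃ (N ^ (f ∸ 1))) * + N
signed-power-peel σ N (suc f) _ = begin
  (σ ◃ 1) * + (N ^ suc f)                  ≡⟨ cong ((σ ◃ 1) *_) (ℤ.+◃n≡+n (N ^ suc f)) ⟨
  (σ ◃ 1) * (Sign.+ ◃ (N ℕ.* N ^ f))       ≡⟨ ℤ.◃-distrib-* σ Sign.+ 1 (N ℕ.* N ^ f) ⟨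
  (σ Sign.* Sign.+) ◃ (1 ℕ.* (N ℕ.* N ^ f)) ≡⟨ cong ((σ Sign.* Sign.+) ◃_) (trans (ℕ.*-identityˡ _) (ℕ.*-comm N (N ^ f))) ⟩
  (σ Sign.* Sign.+) ◃ (N ^ f ℕ.* N)        ≡⟨ ℤ.◃-distrib-* σ Sign.+ (N ^ f) N ⟩
  (σ ◃ (N ^ f)) * (Sign.+ ◃ N)             ≡⟨ cong ((σ ◃ (N ^ f)) *_) (ℤ.+◃n≡+n N) ⟩
  (σ ◃ (N ^ f)) * + N                      ∎
  where open ≡-Reasoning

*-/-cancelʳ : ∀ z N .{{_ : NonZero N}} → (z * + N) / N ≡ z / 1
*-/-cancelʳ z (suc N) = ℚ.fromℚᵘ-cong {mkℚᵘ (z * + suc N) N} {mkℚᵘ z 0} (*≡* (ℤ.*-identityʳ (z * + suc N)))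

Tr-wMatrix≡stateSum*N : ∀ N m (α : Permutation′ (suc m)) → Tr (wMatrix N (suc m) α) ≡ stateSum N (suc m) α * + N
Tr-wMatrix≡stateSum*N N m α = begin
  Tr (wMatrix N (suc m) α)
    ≡⟨ Tr-wMatrix N m α ⟩
  ΣFun (suc m) signs (λ s → sgn s * ΣFun (suc m) (allFin N) (𝟙 ∘ compatibleᵇ α s))
    ≡⟨ ΣFun-cong signs (suc m) (λ s → cong (sgn s *_) (StateGraph.count-compatible α s N)) ⟩
  ΣFun (suc m) signs (λ s → sgn s * + (N ^ f α s))
    ≡⟨ ΣFun-cong signs (suc m) (λ s → signed-power-peel (signOf s) N (f α s) (StateGraph.f-positive α s)) ⟩
  ΣFun (suc m) signs (λ s → (signOf s ◃ (N ^ (f α s ∸ 1))) * + N)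
    ≡⟨ ΣFun-*ʳ signs (suc m) (+ N) (λ s → signOf s ◃ (N ^ (f α s ∸ 1))) ⟨
  stateSum N (suc m) α * + N ∎
  where open ≡-Reasoning

mainTheorem1 : (N : ℕ) .{{_ : NonZero N}} (m : ℕ) → 1 ≤ m → (α : Permutation′ m) →
    wSt-so N m α ≡ stateSum N m α / 1
mainTheorem1 N (suc m) _ α = begin
  Tr (wMatrix N (suc m) α) / N       ≡⟨ cong (_/ N) (Tr-wMatrix≡stateSum*N N m α) ⟩
  (stateSum N (suc m) α * + N) / N   ≡⟨ *-/-cancelʳ (stateSum N (suc m) α) N ⟩
  stateSum N (suc m) α / 1           ∎
  where open ≡-Reasoning
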